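{- Let $r\ge 1$ be an integer and let $G$ and $H$ be finite simple graphs such that $G \xrightarrow{r} H$. Then there is a constant $c=c(G,H,r)$ such that for every positive integer $t$, $G[c^t]$ is canonically $r$-Ramsey for $H[t]$.
   Context: All graphs are finite and simple. We write $G \xrightarrow{r} H$ if every colouring of the edges of $G$ with $r$ colours contains a monochromatic copy of $H$. For a graph $G$ with vertices $v_1,\dots,v_m$ and a positive integer $n$, the $n$-blowup $G[n]$ is obtained by replacing each vertex $v_i$ by an independent set $U_i$ of $n$ vertices (its vertex class) and, for every edge $v_iv_j$ of $G$, putting a complete bipartite graph between $U_i$ and $U_j$. A copy of $H[t]$ in $G[n]$ is called canonical if it is the $t$-blowup of a copy of $H$ in $G$: i.e. there is a copy $H'$ of $H$ in $G$ and, for each vertex $v_i$ of $H'$, a set $S_i\subseteq U_i$ with $|S_i|=t$, and the copy consists of the vertices $\bigcup S_i$ and all edges of $G[n]$ between $S_i$ and $S_j$ for each edge $v_iv_j$ of $H'$. We say $G[n]$ is canonically $r$-Ramsey for $H[t]$ if every $r$-colouring of the edges of $G[n]$ contains a canonical copy of $H[t]$ all of whose edges have the same colour. For non-integer $x$, $G[x]$ means $G[\lceil x\rceil]$. -}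

module Defs where

open import Data.Bool using (Bool; true; false; T)
open import Data.Nat using (ℕ)
open import Data.Fin using (Fin)
open import Data.Product using (_×_; _,_; Σ; ∃)
open import Relation.Binary.PropositionalEquality using (_≡_)
open import Function.Definitions using (Injective)

record Graph (V : Set) : Set where
  field
    adj    : V → V → Bool
    sym    : ∀ u v → adj u v ≡ adj v u
    irrefl : ∀ v → adj v v ≡ false
open Graph public

Edge : {V : Set} → Graph V → V → V → Set
Edge G u v = T (adj G u v)

record Colouring {V : Set} (G : Graph V) (r : ℕ) : Set where
  field
    col    : (u v : V) → Edge G u v → Fin r
    col-sym : ∀ u v (e : Edge G u v) (e' : Edge G v u) → col u v e ≡ col v u e'
open Colouring public

record Copy {V W : Set} (H : Graph W) (G : Graph V) : Set where
  field
    map  : W → V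
    inj  : Injective _≡_ _≡_ map
    pres : ∀ i j → Edge H i j → Edge G (map i) (map j)
open Copy public

Monochromatic : {V W : Set} {G : Graph V} {H : Graph W} {r : ℕ} →
                Colouring G r → Copy H G → Set
Monochromatic {H = H} {r = r} χ φ =
  Σ (Fin r) λ k → ∀ i j (e : Edge H i j) → col χ (map φ i) (map φ j) (pres φ i j e) ≡ k

Arrows : {m h : ℕ} → ℕ → Graph (Fin m) → Graph (Fin h) → Set
Arrows r G H = (χ : Colouring G r) → Σ (Copy H G) λ φ → Monochromatic χ φ

-- The n-blowup G[n]: vertex (i , a) is the a-th vertex of the class U_i.
Blowup : {m : ℕ} → Graph (Fin m) → (n : ℕ) → Graph (Fin m × Fin n)
Blowup G n = record
  { adj    = λ { (i , a) (j , b) → adj G i j }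
  ; sym    = λ { (i , a) (j , b) → sym G i j }
  ; irrefl = λ { (i , a) → irrefl G i }
  }

-- A canonical copy of H[t] in G[n]: a copy H' of H in G together with,
-- for every vertex i of H, a t-subset S_i (given as an injection Fin t → Fin n)
-- of the class U_{φ(i)}.
record CanonicalCopy {m h : ℕ} (H : Graph (Fin h)) (t : ℕ)
                     (G : Graph (Fin m)) (n : ℕ) : Set where
  field
    base : Copy H G
    S    : Fin h → Fin t → Fin n
    S-inj : ∀ i → Injective _≡_ _≡_ (S i)
open CanonicalCopy public

CanonMonochromatic : {m h r t n : ℕ} {H : Graph (Fin h)} {G : Graph (Fin m)} →
                     Colouring (Blowup G n) r → CanonicalCopy H t G n → Set
CanonMonochromatic {r = r} {H = H} χ C =
  Σ (Fin r) λ k → ∀ i j (e : Edge H i j) (a b : _) →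
    col χ (map (base C) i , S C i a) (map (base C) j , S C j b)
          (pres (base C) i j e) ≡ k

CanonRamsey : {m h : ℕ} → ℕ → Graph (Fin m) → ℕ → Graph (Fin h) → ℕ → Set
CanonRamsey r G n H t =
  (χ : Colouring (Blowup G n) r) → Σ (CanonicalCopy H t G n) λ C → CanonMonochromatic χ C

-- In each vertex class U_i of G[n] one finds a t-set S_i such that the colour of an edge
-- between S_i and S_j (i < j) depends only on the pair ij.  Such sets come from repeated
-- pigeonhole.  With m+1 classes, U_0 keeps a reservoir of K = (r+1)^m t vertices, every
-- other class is shrunk by a factor (r+1)^K so that the colour of its edges to a reservoir
-- vertex depends only on that vertex, the other m classes are treated recursively, and a
-- last pigeonhole cuts the reservoir to t vertices.  The class size needed obeys
-- N(m+1) = K + (r+1)^K N(m), hence N(m) ≤ c^t.  The colours between the S_i form an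
-- r-colouring of G, so G →r H gives a monochromatic copy of H, and its blowup by the S_i
-- is a monochromatic canonical H[t].
module Submission where

open import Defs
open import Data.Nat using (ℕ; zero; suc; pred; _+_; _*_; _^_; _≤_; z≤n; s≤s; s≤s⁻¹)
open import Data.Nat.Properties
  using ( +-0-commutativeMonoid; ≤-reflexive; ≤-trans; m≤m+n; m≤n+m; n≤0⇒n≡0
        ; +-mono-≤; *-monoʳ-≤; ^-monoˡ-≤; m^n>0; +-identityʳ; *-assoc
        ; *-distribʳ-+; ^-*-assoc; [m*n]*[o*p]≡[m*o]*[n*p]; module ≤-Reasoning )
open import Data.Fin using (Fin; zero; suc; inject≤; punchIn)
  renaming (_<_ to _<ᶠ_)
open import Data.Fin.Properties
  using ( _≟_; <-cmp; suc-injective; ↑ˡ-injective; ↑ʳ-injective; inject≤-injective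
        ; lift-injective; punchInᵢ≢i )
open import Data.Vec.Functional using (updateAt; removeAt)
open import Data.Vec.Functional.Properties using (updateAt-updates; updateAt-minimal)
open import Algebra.Properties.CommutativeMonoid.Sum +-0-commutativeMonoid
  using (sum; sum-remove; sum-cong-≗)
open import Data.Product using (Σ; ∃; _,_)
open import Data.Bool using (Bool; true; false; T)
open import Data.Unit using (tt)
open import Data.Empty using (⊥-elim)
open import Function.Base using (_∘_)
open import Function.Bundles using (Injection; _↣_; mk↣)
open import Function.Construct.Identity using (↣-id)
open import Function.Construct.Composition using (_↣-∘_)
open import Relation.Binary.Definitions using (tri<; tri≈; tri>)
open import Relation.Binary.PropositionalEquality as ≡
  using (_≡_; refl; cong; cong₂; subst; trans; module ≡-Reasoning)
open import Relation.Nullary using (yes; no)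

open Injection using (to; injective)

record ColourClass {n} {C : Set} (c : Fin n → C) (k : C) (A : ℕ) : Set where
  constructor colourClass
  field
    members  : Fin A ↣ Fin n
    coloured : ∀ a → c (to members a) ≡ k

colourClass-zero : ∀ {n} {C : Set} {c : Fin n → C} {k} → ColourClass c k 0
colourClass-zero = colourClass (mk↣ {to = λ ()} (λ { {()} })) λ ()

colourClass-suc : ∀ {n A} {C : Set} {c : Fin (suc n) → C} {k} →
                  ColourClass (c ∘ suc) k A → ColourClass c k A
colourClass-suc (colourClass R R-colour) = colourClass (mk↣ {to = suc} suc-injective ↣-∘ R) R-colour

colourClass-cons : ∀ {n A} {C : Set} {c : Fin (suc n) → C} {k} → c zero ≡ k →
                   ColourClass (c ∘ suc) k A → ColourClass c k (suc A)
colourClass-cons c₀≡k (colourClass R R-colour) =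
  colourClass (mk↣ (lift-injective (to R) (injective R) 1)) λ { zero → c₀≡k ; (suc a) → R-colour a }

sum-updateAt : ∀ {n} (s : Fin (suc n) → ℕ) k f →
               sum (updateAt s k f) ≡ f (s k) + sum (removeAt s k)
sum-updateAt s k f = begin
  sum (updateAt s k f)                                 ≡⟨ sum-remove {i = k} (updateAt s k f) ⟩
  updateAt s k f k + sum (removeAt (updateAt s k f) k) ≡⟨ cong₂ _+_ (updateAt-updates k s) untouched ⟩
  f (s k) + sum (removeAt s k)                         ∎
  where
  open ≡-Reasoning
  untouched = sum-cong-≗ λ j → updateAt-minimal (punchIn k j) k s (punchInᵢ≢i k j)

sum-decrement : ∀ {n} (s : Fin (suc n) → ℕ) k {q} → s k ≡ suc q →
                suc (sum (updateAt s k pred)) ≡ sum s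
sum-decrement s k {q} sk≡1+q = begin
  suc (sum (updateAt s k pred))         ≡⟨ cong suc (sum-updateAt s k pred) ⟩
  suc (pred (s k)) + sum (removeAt s k) ≡⟨ cong (λ x → suc (pred x) + sum (removeAt s k)) sk≡1+q ⟩
  suc q + sum (removeAt s k)            ≡⟨ cong (_+ sum (removeAt s k)) sk≡1+q ⟨
  s k + sum (removeAt s k)              ≡⟨ sum-remove s ⟨
  sum s                                 ∎
  where open ≡-Reasoning

pigeonhole-quotas : ∀ {n r} (c : Fin n → Fin (suc r)) (s : Fin (suc r) → ℕ) → sum s ≤ n →
                    ∃ λ k → ColourClass c k (s k)
pigeonhole-quotas {zero} c s Σs≤0 =
  zero , subst (ColourClass c zero) (≡.sym (n≤0⇒n≡0 (≤-trans (m≤m+n (s zero) _) Σs≤0))) colourClass-zero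
-- Vertex 0 is charged against the quota of its own colour.
pigeonhole-quotas {suc n} c s Σs≤1+n with s (c zero) in s₀≡
... | zero  = c zero , subst (ColourClass c (c zero)) (≡.sym s₀≡) colourClass-zero
... | suc q with pigeonhole-quotas (c ∘ suc) (updateAt s (c zero) pred) Σs′≤n
  where
  Σs′≤n = s≤s⁻¹ (subst (_≤ suc n) (≡.sym (sum-decrement s (c zero) s₀≡)) Σs≤1+n)
...   | k , class with k ≟ c zero
...     | yes refl = k , subst (ColourClass c k) (≡.sym s₀≡) (colourClass-cons refl class′)
  where
  class′ = subst (ColourClass (c ∘ suc) k) (trans (updateAt-updates k s) (cong pred s₀≡)) class
...     | no k≢c₀ =
  k , colourClass-suc (subst (ColourClass (c ∘ suc) k) (updateAt-minimal k (c zero) s k≢c₀) class)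

sum-const : ∀ n M → sum {n} (λ _ → M) ≡ n * M
sum-const zero    M = refl
sum-const (suc n) M = cong (M +_) (sum-const n M)

pigeonhole : ∀ {r} M (c : Fin (suc r * M) → Fin (suc r)) → ∃ λ k → ColourClass c k M
pigeonhole {r} M c = pigeonhole-quotas c (λ _ → M) (≤-reflexive (sum-const (suc r) M))

jointSize : ℕ → ℕ → ℕ → ℕ
jointSize r zero    M = M
jointSize r (suc T) M = suc r * jointSize r T M

jointSize≡ : ∀ r T M → jointSize r T M ≡ suc r ^ T * M
jointSize≡ r zero    M = ≡.sym (+-identityʳ M)
jointSize≡ r (suc T) M =
  trans (cong (suc r *_) (jointSize≡ r T M)) (≡.sym (*-assoc (suc r) (suc r ^ T) M))

record JointlyConstant {r T n} (h : Fin T → Fin n → Fin (suc r)) (M : ℕ) : Set where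
  field
    subset   : Fin M ↣ Fin n
    colour   : Fin T → Fin (suc r)
    constant : ∀ a y → h a (to subset y) ≡ colour a

jointPigeonhole : ∀ {r} T M (h : Fin T → Fin (jointSize r T M) → Fin (suc r)) → JointlyConstant h M
jointPigeonhole zero M h = record { subset = ↣-id (Fin M) ; colour = λ () ; constant = λ () }
jointPigeonhole {r} (suc T) M h with pigeonhole (jointSize r T M) (h zero)
... | k , colourClass R R-colour = record
  { subset   = R ↣-∘ subset
  ; colour   = λ { zero → k ; (suc a) → colour a }
  ; constant = λ { zero y → R-colour (to subset y) ; (suc a) y → constant a y }
  }
  where open JointlyConstant (jointPigeonhole T M (λ a → h (suc a) ∘ to R))

PairColouring : ℕ → ℕ → ℕ → Set
PairColouring r m n = Fin m → Fin m → Fin n → Fin n → Fin (suc r)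

record HomogeneousSets {r m n} (f : PairColouring r m n) (t : ℕ) : Set where
  field
    subset      : Fin m → Fin t ↣ Fin n
    profile     : Fin m → Fin m → Fin (suc r)
    homogeneous : ∀ {i j} → i <ᶠ j → ∀ a b → f i j (to (subset i) a) (to (subset j) b) ≡ profile i j

classSize : ℕ → ℕ → ℕ → ℕ
classSize r zero    t = 0
classSize r (suc m) t = jointSize r m t + jointSize r (jointSize r m t) (classSize r m t)

homogeneousSets : ∀ {r} m t (f : PairColouring r m (classSize r m t)) → HomogeneousSets f t
homogeneousSets zero t f = record { subset = λ () ; profile = λ () ; homogeneous = λ { {()} } }
homogeneousSets {r} (suc m) t f = record
  { subset      = subset
  ; profile     = profile
  ; homogeneous = homogeneous
  }
  where
  K = jointSize r m t
  M = classSize r m t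

  reservoir : Fin K ↣ Fin (classSize r (suc m) t)
  reservoir = mk↣ (↑ˡ-injective (jointSize r K M) _ _)

  remainder : Fin (jointSize r K M) ↣ Fin (classSize r (suc m) t)
  remainder = mk↣ (↑ʳ-injective K _ _)

  module Cross (j : Fin m) =
    JointlyConstant (jointPigeonhole K M λ a y → f zero (suc j) (to reservoir a) (to remainder y))

  module Inner = HomogeneousSets
    (homogeneousSets m t λ i j y z → f (suc i) (suc j) (to remainder (to (Cross.subset i) y))
                                                       (to remainder (to (Cross.subset j) z)))

  module Base = JointlyConstant (jointPigeonhole m t Cross.colour)

  subset : Fin (suc m) → Fin t ↣ Fin (classSize r (suc m) t)
  subset zero    = reservoir ↣-∘ Base.subset
  subset (suc j) = remainder ↣-∘ (Cross.subset j ↣-∘ Inner.subset j)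

  profile : Fin (suc m) → Fin (suc m) → Fin (suc r)
  profile zero    (suc j) = Base.colour j
  profile (suc i) (suc j) = Inner.profile i j
  profile _       zero    = zero

  homogeneous : ∀ {i j} → i <ᶠ j → ∀ a b → f i j (to (subset i) a) (to (subset j) b) ≡ profile i j
  homogeneous {zero}  {suc j} _         a b =
    trans (Cross.constant j (to Base.subset a) (to (Inner.subset j) b)) (Base.constant j a)
  homogeneous {suc i} {suc j} (s≤s i<j) a b = Inner.homogeneous i<j a b

onTrue : {A : Set} → A → (b : Bool) → (T b → A) → A
onTrue a false _ = a
onTrue _ true  k = k tt

onTrue-T : ∀ {A : Set} (a : A) b (k : T b → A) (e : T b) → onTrue a b k ≡ k e
onTrue-T a true k tt = refl

-- Non-edges of G receive the junk colour zero.
pairColouring : ∀ {r m n} {G : Graph (Fin m)} → Colouring (Blowup G n) (suc r) → PairColouring r m n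
pairColouring {G = G} χ i j x y = onTrue zero (adj G i j) (col χ (i , x) (j , y))

module _ {r m n t} {G : Graph (Fin m)} (χ : Colouring (Blowup G n) (suc r))
         (sets : HomogeneousSets (pairColouring χ) t) where

  open HomogeneousSets sets

  edgeColour : ∀ {u v} → Edge G u v → Fin t → Fin t → Fin (suc r)
  edgeColour {u} {v} e a b = col χ (u , to (subset u) a) (v , to (subset v) b) e

  edgeColour-ordered : ∀ {u v} (e : Edge G u v) → u <ᶠ v → ∀ a b → edgeColour e a b ≡ profile u v
  edgeColour-ordered {u} {v} e u<v a b =
    trans (≡.sym (onTrue-T zero (adj G u v) _ e)) (homogeneous u<v a b)

  edgeColour-canonical : ∀ {u v} (e : Edge G u v) a b a′ b′ → edgeColour e a b ≡ edgeColour e a′ b′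
  edgeColour-canonical {u} {v} e a b a′ b′ with <-cmp u v
  ... | tri< u<v _ _ = trans (edgeColour-ordered e u<v a b) (≡.sym (edgeColour-ordered e u<v a′ b′))
  ... | tri≈ _ refl _ = ⊥-elim (subst T (irrefl G u) e)
  ... | tri> _ _ v<u = trans (flipped a b) (≡.sym (flipped a′ b′))
    where
    e′ : Edge G v u
    e′ = subst T (sym G u v) e
    flipped : ∀ a b → edgeColour e a b ≡ profile v u
    flipped a b = trans (col-sym χ _ _ e e′) (edgeColour-ordered e′ v<u b a)

  inducedColouring : Fin t → Colouring G (suc r)
  inducedColouring a₀ = record
    { col     = λ u v e → edgeColour e a₀ a₀
    ; col-sym = λ u v e e′ → col-sym χ _ _ e e′
    }

  canonicalCopy : ∀ {h} {H : Graph (Fin h)} → Copy H G → CanonicalCopy H t G n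
  canonicalCopy φ = record
    { base  = φ
    ; S     = to ∘ subset ∘ map φ
    ; S-inj = injective ∘ subset ∘ map φ
    }

  canonicalCopy-monochromatic : ∀ {h} {H : Graph (Fin h)} a₀ (φ : Copy H G) →
    Monochromatic (inducedColouring a₀) φ → CanonMonochromatic χ (canonicalCopy φ)
  canonicalCopy-monochromatic a₀ φ (k , φ-mono) =
    k , λ i j e a b → trans (edgeColour-canonical (pres φ i j e) a b a₀ a₀) (φ-mono i j e)

homogeneousSets⇒canonRamsey : ∀ {r m h n t} {G : Graph (Fin m)} {H : Graph (Fin h)} → Arrows (suc r) G H →
  (∀ (χ : Colouring (Blowup G n) (suc r)) → HomogeneousSets (pairColouring χ) (suc t)) →
  CanonRamsey (suc r) G n H (suc t)
homogeneousSets⇒canonRamsey arrows setsOf χ =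
  let φ , φ-mono = arrows (inducedColouring χ (setsOf χ) zero)
  in  canonicalCopy χ (setsOf χ) φ , canonicalCopy-monochromatic χ (setsOf χ) zero φ φ-mono

restrict : ∀ {r m n n′} {G : Graph (Fin m)} → n ≤ n′ → Colouring (Blowup G n′) r → Colouring (Blowup G n) r
restrict n≤n′ χ = record
  { col     = λ { (u , x) (v , y) e → col χ (u , inject≤ x n≤n′) (v , inject≤ y n≤n′) e }
  ; col-sym = λ { (u , x) (v , y) e e′ → col-sym χ _ _ e e′ }
  }

canonRamsey-mono : ∀ {r m h n n′ t} {G : Graph (Fin m)} {H : Graph (Fin h)} → n ≤ n′ →
                   CanonRamsey r G n H t → CanonRamsey r G n′ H t
canonRamsey-mono n≤n′ ramsey χ with ramsey (restrict n≤n′ χ)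
... | C , k , C-mono = C′ , k , C-mono
  where
  C′ = record
    { base  = base C
    ; S     = λ i a → inject≤ (S C i a) n≤n′
    ; S-inj = λ i → S-inj C i ∘ inject≤-injective n≤n′ n≤n′ _ _
    }

n≤2^n : ∀ n → n ≤ 2 ^ n
n≤2^n zero    = z≤n
n≤2^n (suc n) = +-mono-≤ (m^n>0 2 n) (≤-trans (n≤2^n n) (m≤m+n (2 ^ n) 0))

^-distribʳ-* : ∀ m n o → (m * n) ^ o ≡ m ^ o * n ^ o
^-distribʳ-* m n zero    = refl
^-distribʳ-* m n (suc o) =
  trans (cong ((m * n) *_) (^-distribʳ-* m n o)) ([m*n]*[o*p]≡[m*o]*[n*p] m n (m ^ o) (n ^ o))

m^n+o^n≤[m+o]^n : ∀ m o n → m ^ suc n + o ^ suc n ≤ (m + o) ^ suc n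
m^n+o^n≤[m+o]^n m o n = begin
  m * m ^ n + o * o ^ n             ≤⟨ +-mono-≤ (*-monoʳ-≤ m (^-monoˡ-≤ n (m≤m+n m o)))
                                                (*-monoʳ-≤ o (^-monoˡ-≤ n (m≤n+m o m))) ⟩
  m * (m + o) ^ n + o * (m + o) ^ n ≡⟨ *-distribʳ-+ ((m + o) ^ n) m o ⟨
  (m + o) * (m + o) ^ n             ∎
  where open ≤-Reasoning

classSizeBase : ℕ → ℕ → ℕ
classSizeBase r zero    = 0
classSizeBase r (suc m) = 2 ^ P + suc r ^ P * classSizeBase r m
  where P = suc r ^ m

classSize≤ : ∀ r m t → classSize r m (suc t) ≤ classSizeBase r m ^ suc t
classSize≤ r zero    t = z≤n
classSize≤ r (suc m) t = begin
  jointSize r m (suc t) + jointSize r K M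
    ≡⟨ cong₂ _+_ (jointSize≡ r m (suc t))
                 (trans (jointSize≡ r K M) (cong (λ x → suc r ^ x * M) (jointSize≡ r m (suc t)))) ⟩
  P * suc t + suc r ^ (P * suc t) * M
    ≤⟨ +-mono-≤ (n≤2^n (P * suc t)) (*-monoʳ-≤ (suc r ^ (P * suc t)) (classSize≤ r m t)) ⟩
  2 ^ (P * suc t) + suc r ^ (P * suc t) * c ^ suc t
    ≡⟨ cong₂ _+_ (^-*-assoc 2 P (suc t)) (cong (_* c ^ suc t) (^-*-assoc (suc r) P (suc t))) ⟨
  (2 ^ P) ^ suc t + (suc r ^ P) ^ suc t * c ^ suc t
    ≡⟨ cong ((2 ^ P) ^ suc t +_) (^-distribʳ-* (suc r ^ P) c (suc t)) ⟨
  (2 ^ P) ^ suc t + (suc r ^ P * c) ^ suc t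
    ≤⟨ m^n+o^n≤[m+o]^n (2 ^ P) (suc r ^ P * c) t ⟩
  (2 ^ P + suc r ^ P * c) ^ suc t
    ∎
  where
  open ≤-Reasoning
  P = suc r ^ m
  K = jointSize r m (suc t)
  M = classSize r m (suc t)
  c = classSizeBase r m

theorem1p1 : (r : ℕ) → 1 ≤ r → {m h : ℕ} (G : Graph (Fin m)) (H : Graph (Fin h)) →
    Arrows r G H →
    Σ ℕ (λ c → (t : ℕ) → 1 ≤ t → CanonRamsey r G (c ^ t) H t)
theorem1p1 (suc r) _ {m} G H arrows = classSizeBase r m , λ where
  (suc t) _ → canonRamsey-mono (classSize≤ r m t)
                (homogeneousSets⇒canonRamsey arrows λ χ → homogeneousSets m (suc t) (pairColouring χ))
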